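{- For every $n\ge 0$, the Hankel determinant $H_{n}(\alpha_{k}(x))$ is a polynomial in $x$ of degree $n(n+1)$ with leading coefficient \begin{equation*} \big[x^{n(n+1)}\big]H_{n}(\alpha_{k}(x))=\alpha_{0}^{n+1}(-1)^{\binom{n+1}{2}}q^{3\binom{n+1}{3}}\prod_{j=1}^{n}(1-q^{j})^{n+1-j}. \end{equation*}
   Context: For a sequence $(a_k)_{k\ge0}$, $H_n(a_k):=\det_{0\le i,j\le n}(a_{i+j})$ denotes its $n$-th Hankel determinant. The $q$-Pochhammer symbol is $(A;q)_N:=\prod_{k=0}^{N-1}(1-Aq^k)$, and the $q$-binomial coefficient is $\genfrac{[}{]}{0pt}{}{n}{k}_q:=\frac{(q;q)_n}{(q;q)_k(q;q)_{n-k}}$ for $0\le k\le n$ and $0$ otherwise. Let $(\alpha_k)_{k\ge0}$ be an arbitrary sequence and define the polynomials \begin{align*} \alpha_{k}(x):=\sum_{\ell=0}^{k}q^{\binom{\ell}{2}}\genfrac{[}{]}{0pt}{}{k}{\ell}_{q}\alpha_{k-\ell}x^{\ell}. \end{align*} -}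

module Defs where

open import Level using (Level)
open import Algebra.Bundles using (CommutativeRing)
open import Data.Nat using (ℕ; zero; suc; _∸_)
open import Data.Nat.Combinatorics using (_C_)
open import Data.Fin using (Fin; toℕ; punchIn)
import Data.Fin as F
open import Data.List using (List; []; _∷_; map; foldr; upTo; allFin)

module _ {c ℓ : Level} (R : CommutativeRing c ℓ) where
  open CommutativeRing R

  pow : Carrier → ℕ → Carrier
  pow a zero = 1#
  pow a (suc k) = a * pow a k

  -- Gaussian (q-)binomial coefficient [n choose k]_q, as a polynomial in q,
  -- via the q-Pascal recurrence; equals (q;q)_n / ((q;q)_k (q;q)_{n-k}),
  -- and is 0 for k > n.
  qbinom : Carrier → ℕ → ℕ → Carrier
  qbinom q n zero = 1#
  qbinom q zero (suc k) = 0#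
  qbinom q (suc n) (suc k) = qbinom q n k + pow q (suc k) * qbinom q n (suc k)

  -- Polynomials in x over R: coefficient lists, lowest degree first.
  Poly : Set c
  Poly = List Carrier

  coeff : Poly → ℕ → Carrier
  coeff [] m = 0#
  coeff (a ∷ p) zero = a
  coeff (a ∷ p) (suc m) = coeff p m

  padd : Poly → Poly → Poly
  padd [] p = p
  padd (a ∷ p) [] = a ∷ p
  padd (a ∷ p) (b ∷ r) = (a + b) ∷ padd p r

  pneg : Poly → Poly
  pneg = map (-_)

  pmul : Poly → Poly → Poly
  pmul [] r = []
  pmul (a ∷ p) r = padd (map (a *_) r) (0# ∷ pmul p r)

  psum : List Poly → Poly
  psum = foldr padd []

  psign : ℕ → Poly → Poly
  psign zero p = p
  psign (suc k) p = pneg (psign k p)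

  det : (n : ℕ) → (Fin n → Fin n → Poly) → Poly
  det zero M = 1# ∷ []
  det (suc n) M = psum (map term (allFin (suc n)))
    where
    term : Fin (suc n) → Poly
    term i = psign (toℕ i)
               (pmul (M i F.zero) (det n (λ a b → M (punchIn i a) (F.suc b))))

  hankel : (ℕ → Poly) → ℕ → Poly
  hankel a n = det (suc n) (λ i j → a (toℕ i Data.Nat.+ toℕ j))

  alphaPoly : Carrier → (ℕ → Carrier) → ℕ → Poly
  alphaPoly q α k =
    map (λ l → pow q (l C 2) * (qbinom q k l * α (k ∸ l))) (upTo (suc k))

  leadCoeff : Carrier → (ℕ → Carrier) → ℕ → Carrier
  leadCoeff q α n =
    pow (α 0) (suc n) * (pow (- 1#) (suc n C 2) * (pow q (3 Data.Nat.* (suc n C 3)) *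
      foldr _*_ 1# (map (λ j → pow (1# - pow q (suc j)) (n ∸ j)) (upTo n))))

-- Every entry α_{i+j}(x) has degree i + j with top coefficient α₀ q^C(i+j,2), so the
-- coefficient of x^(Σi + Σj) = x^(n(n+1)) in H_n is α₀^(n+1) det(q^C(i+j,2)) and nothing lies
-- above it.  This q-determinant is evaluated inside the family q^(s·i + C(i+j,2)): subtracting
-- q^(s+i) times row i from row i+1 turns the first column into (1,0,…,0) and leaves the
-- member s+2 of the family, with column j scaled by q^(s+j)(q^(j+1) − 1).
module Submission where

open import Defs
open import Level using (Level)
open import Algebra.Bundles using (CommutativeRing)
open import Data.Nat using (ℕ; zero; suc; _≤_; _<_; z≤n; s≤s; _∸_; _≤?_)
import Data.Nat as N
import Data.Nat.Properties as NP
open import Data.Nat.Combinatorics using (_C_; nCk+nC[k+1]≡[n+1]C[k+1]; nC1≡n)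
open import Data.Nat.Tactic.RingSolver using (solve-∀)
open import Data.Fin using (Fin; toℕ; punchIn; punchOut; inject₁)
import Data.Fin as F
import Data.Fin.Properties as FP
open import Data.List using ([]; _∷_; map; foldr; upTo; tabulate; applyUpTo)
import Data.List.Properties as LP
open import Data.Product using (_×_; Σ-syntax; _,_; proj₁; proj₂)
open import Data.Empty using (⊥-elim)
open import Relation.Nullary using (yes; no)
open import Relation.Binary.PropositionalEquality as ≡ using (_≡_; _≢_)
open import Function using (_∘_)
import Algebra.Properties.CommutativeMonoid.Sum as CommutativeMonoidSum
import Algebra.Properties.CommutativeSemigroup as CommutativeSemigroupProperties
import Algebra.Solver.CommutativeMonoid

module ℕ-Sum = CommutativeMonoidSum NP.+-0-commutativeMonoid
module ℕ-Semigroup = CommutativeSemigroupProperties NP.+-commutativeSemigroup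

module _ where
  open Data.Nat using (_+_; _*_)
  open ≡.≡-Reasoning

  C2-suc : ∀ m → suc m C 2 ≡ m C 2 + m
  C2-suc m = ≡.trans (≡.sym (nCk+nC[k+1]≡[n+1]C[k+1] m 1))
                     (≡.trans (≡.cong (_+ m C 2) (nC1≡n m)) (NP.+-comm m _))

  C3-suc : ∀ m → suc m C 3 ≡ m C 2 + m C 3
  C3-suc m = ≡.sym (nCk+nC[k+1]≡[n+1]C[k+1] m 2)

  sum-toℕ-offset : ∀ m s → ℕ-Sum.sum {m} (λ b → s + toℕ b) ≡ m * s + m C 2
  sum-toℕ-offset zero s = ≡.refl
  sum-toℕ-offset (suc m) s = begin
    s + 0 + ℕ-Sum.sum {m} (λ b → s + suc (toℕ b))
      ≡⟨ ≡.cong (s + 0 +_) (≡.trans (ℕ-Sum.sum-cong-≗ {m} (λ b → NP.+-suc s (toℕ b)))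
                                    (sum-toℕ-offset m (suc s))) ⟩
    s + 0 + (m * suc s + m C 2)  ≡⟨ arithmetic s m (m C 2) ⟩
    suc m * s + (m C 2 + m)      ≡⟨ ≡.cong (suc m * s +_) (C2-suc m) ⟨
    suc m * s + suc m C 2        ∎
    where
    arithmetic : ∀ s m c → s + 0 + (m * suc s + c) ≡ suc m * s + (c + m)
    arithmetic = solve-∀

  sum-toℕ : ∀ m → ℕ-Sum.sum {m} toℕ ≡ m C 2
  sum-toℕ m = ≡.trans (sum-toℕ-offset m 0) (≡.cong (_+ m C 2) (NP.*-zeroʳ m))

  C2-double : ∀ n → suc n C 2 + suc n C 2 ≡ n * suc n
  C2-double zero = ≡.refl
  C2-double (suc n) = begin
    suc (suc n) C 2 + suc (suc n) C 2          ≡⟨ ≡.cong₂ _+_ (C2-suc (suc n)) (C2-suc (suc n)) ⟩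
    (suc n C 2 + suc n) + (suc n C 2 + suc n)  ≡⟨ ℕ-Semigroup.interchange (suc n C 2) (suc n) _ _ ⟩
    (suc n C 2 + suc n C 2) + (suc n + suc n)  ≡⟨ ≡.cong (_+ (suc n + suc n)) (C2-double n) ⟩
    n * suc n + (suc n + suc n)                ≡⟨ arithmetic n ⟩
    suc n * suc (suc n)                        ∎
    where
    arithmetic : ∀ n → n * suc n + (suc n + suc n) ≡ suc n * suc (suc n)
    arithmetic = solve-∀

  qExponent : ℕ → ℕ → ℕ → ℕ
  qExponent s i j = s * i + (i + j) C 2

  qExponent-next-row : ∀ s a j → qExponent s (suc a) j ≡ (s + a) + j + qExponent s a j
  qExponent-next-row s a j = begin
    s * suc a + suc (a + j) C 2             ≡⟨ ≡.cong (s * suc a +_) (C2-suc (a + j)) ⟩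
    s * suc a + ((a + j) C 2 + (a + j))     ≡⟨ arithmetic s a j ((a + j) C 2) ⟩
    (s + a) + j + qExponent s a j           ∎
    where
    arithmetic : ∀ s a j c → s * suc a + (c + (a + j)) ≡ (s + a) + j + (s * a + c)
    arithmetic = solve-∀

  qExponent-shift : ∀ s a b → (s + a) + qExponent s a (suc b) ≡ (s + b) + qExponent (s + 2) a b
  qExponent-shift s a b = begin
    (s + a) + (s * a + (a + suc b) C 2)        ≡⟨ ≡.cong (λ c → (s + a) + (s * a + c C 2)) (NP.+-suc a b) ⟩
    (s + a) + (s * a + suc (a + b) C 2)        ≡⟨ ≡.cong (λ c → (s + a) + (s * a + c)) (C2-suc (a + b)) ⟩
    (s + a) + (s * a + ((a + b) C 2 + (a + b))) ≡⟨ arithmetic s a b ((a + b) C 2) ⟩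
    (s + b) + qExponent (s + 2) a b            ∎
    where
    arithmetic : ∀ s a b c → (s + a) + (s * a + (c + (a + b))) ≡ (s + b) + ((s + 2) * a + c)
    arithmetic = solve-∀

  qDetExponent-step : ∀ s n →
    ℕ-Sum.sum {suc n} (λ b → s + toℕ b) + ((s + 2) * (suc n C 2) + 3 * (suc n C 3))
    ≡ s * (suc (suc n) C 2) + 3 * (suc (suc n) C 3)
  qDetExponent-step s n = begin
    ℕ-Sum.sum {suc n} (λ b → s + toℕ b) + ((s + 2) * c₂ + 3 * c₃)
      ≡⟨ ≡.cong (_+ ((s + 2) * c₂ + 3 * c₃)) (sum-toℕ-offset (suc n) s) ⟩
    (suc n * s + c₂) + ((s + 2) * c₂ + 3 * c₃)
      ≡⟨ arithmetic s (suc n) c₂ c₃ ⟩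
    s * (c₂ + suc n) + 3 * (c₂ + c₃)
      ≡⟨ ≡.cong₂ (λ u v → s * u + 3 * v) (C2-suc (suc n)) (C3-suc (suc n)) ⟨
    s * (suc (suc n) C 2) + 3 * (suc (suc n) C 3)
      ∎
    where
    c₂ = suc n C 2
    c₃ = suc n C 3
    arithmetic : ∀ s m c₂ c₃ → (m * s + c₂) + ((s + 2) * c₂ + 3 * c₃) ≡ s * (c₂ + m) + 3 * (c₂ + c₃)
    arithmetic = solve-∀

punchIn-inject₁-self : ∀ {n} (k : Fin n) → punchIn (inject₁ k) k ≡ F.suc k
punchIn-inject₁-self F.zero = ≡.refl
punchIn-inject₁-self (F.suc k) = ≡.cong F.suc (punchIn-inject₁-self k)

punchIn-suc-self : ∀ {n} (k : Fin n) → punchIn (F.suc k) k ≡ inject₁ k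
punchIn-suc-self F.zero = ≡.refl
punchIn-suc-self (F.suc k) = ≡.cong F.suc (punchIn-suc-self k)

punchIn-adjacent : ∀ {n} {a k : Fin n} → a ≢ k → punchIn (F.suc k) a ≡ punchIn (inject₁ k) a
punchIn-adjacent {a = F.zero} {F.zero} a≢k = ⊥-elim (a≢k ≡.refl)
punchIn-adjacent {a = F.zero} {F.suc k} a≢k = ≡.refl
punchIn-adjacent {a = F.suc a} {F.zero} a≢k = ≡.refl
punchIn-adjacent {a = F.suc a} {F.suc k} a≢k = ≡.cong F.suc (punchIn-adjacent (a≢k ∘ ≡.cong F.suc))

punchIn-adjacent-preimage : ∀ {n} (i : Fin (suc (suc n))) (k : Fin (suc n)) →
  i ≢ inject₁ k → i ≢ F.suc k →
  Σ[ k₂ ∈ Fin n ] (punchIn i (inject₁ k₂) ≡ inject₁ k × punchIn i (F.suc k₂) ≡ F.suc k)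
punchIn-adjacent-preimage F.zero F.zero ne ne′ = ⊥-elim (ne ≡.refl)
punchIn-adjacent-preimage F.zero (F.suc k) ne ne′ = k , ≡.refl , ≡.refl
punchIn-adjacent-preimage (F.suc F.zero) F.zero ne ne′ = ⊥-elim (ne′ ≡.refl)
punchIn-adjacent-preimage {suc n} (F.suc (F.suc i)) F.zero ne ne′ = F.zero , ≡.refl , ≡.refl
punchIn-adjacent-preimage {suc n} (F.suc i) (F.suc k) ne ne′
  with punchIn-adjacent-preimage i k (ne ∘ ≡.cong F.suc) (ne′ ∘ ≡.cong F.suc)
... | k₂ , e , e′ = F.suc k₂ , ≡.cong F.suc e , ≡.cong F.suc e′

inject₁≢suc : ∀ {n} (k : Fin n) → inject₁ k ≢ F.suc k
inject₁≢suc F.zero ()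
inject₁≢suc (F.suc k) = inject₁≢suc k ∘ FP.suc-injective

replaceRow : ∀ {a} {A : Set a} {n m} → (Fin n → Fin m → A) → Fin n → (Fin m → A) → Fin n → Fin m → A
replaceRow M k r i with i FP.≟ k
... | yes _ = r
... | no _ = M i

replaceRow-≢ : ∀ {a} {A : Set a} {n m} (M : Fin n → Fin m → A) {k} r {i} → i ≢ k → replaceRow M k r i ≡ M i
replaceRow-≢ M {k} r {i} i≢k with i FP.≟ k
... | yes i≡k = ⊥-elim (i≢k i≡k)
... | no _ = ≡.refl

replaceRow-≡ : ∀ {a} {A : Set a} {n m} (M : Fin n → Fin m → A) k r → replaceRow M k r k ≡ r
replaceRow-≡ M k r with k FP.≟ k
... | yes _ = ≡.refl
... | no k≢k = ⊥-elim (k≢k ≡.refl)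
module _ {c ℓ : Level} (R : CommutativeRing c ℓ) where
  open CommutativeRing R hiding (zero)
  open import Algebra.Properties.Ring ring
    using (-‿distribˡ-*; -‿distribʳ-*; -0#≈0#; -‿+-comm; -1*x≈-x; -‿involutive)
  open import Algebra.Properties.Semiring.Sum semiring
    using (sum; sum-syntax; sum-cong-≋; ∑-distrib-+; *-distribˡ-sum; sum-replicate-zero)
  open import Algebra.Properties.CommutativeMonoid.Sum *-commutativeMonoid using ()
    renaming (sum to product; sum-cong-≋ to product-cong; ∑-distrib-+ to product-distrib-*;
              sum-init-last to product-init-last)
  open import Algebra.Properties.CommutativeSemigroup *-commutativeSemigroup
    using (interchange; x∙yz≈y∙xz; xy∙z≈y∙xz)
  open import Relation.Binary.Reasoning.Setoid setoid
  module CM = Algebra.Solver.CommutativeMonoid *-commutativeMonoid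

  signed : ℕ → Carrier → Carrier
  signed zero x = x
  signed (suc k) x = - signed k x

  signed-cong : ∀ k {x y} → x ≈ y → signed k x ≈ signed k y
  signed-cong zero e = e
  signed-cong (suc k) e = -‿cong (signed-cong k e)

  signed-+ : ∀ k x y → signed k (x + y) ≈ signed k x + signed k y
  signed-+ zero x y = refl
  signed-+ (suc k) x y = trans (-‿cong (signed-+ k x y)) (sym (-‿+-comm _ _))

  signed-*ˡ : ∀ k a x → signed k (a * x) ≈ a * signed k x
  signed-*ˡ zero a x = refl
  signed-*ˡ (suc k) a x = trans (-‿cong (signed-*ˡ k a x)) (-‿distribʳ-* a _)

  signed-zero : ∀ k {x} → x ≈ 0# → signed k x ≈ 0#
  signed-zero zero e = e
  signed-zero (suc k) e = trans (-‿cong (signed-zero k e)) -0#≈0#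

  pow-+ : ∀ x m n → pow R x (m N.+ n) ≈ pow R x m * pow R x n
  pow-+ x zero n = sym (*-identityˡ _)
  pow-+ x (suc m) n = trans (*-congˡ (pow-+ x m n)) (sym (*-assoc x _ _))

  pow-cong : ∀ x {m n} → m ≡ n → pow R x m ≈ pow R x n
  pow-cong x ≡.refl = refl

  product-const : ∀ m a → product {m} (λ _ → a) ≈ pow R a m
  product-const zero a = refl
  product-const (suc m) a = *-congˡ (product-const m a)

  product-pow : ∀ m x (f : Fin m → ℕ) → product (λ b → pow R x (f b)) ≈ pow R x (ℕ-Sum.sum f)
  product-pow zero x f = refl
  product-pow (suc m) x f = trans (*-congˡ (product-pow m x (f ∘ F.suc))) (sym (pow-+ x (f F.zero) _))

  product-neg : ∀ m (f : Fin m → Carrier) → product (λ b → - f b) ≈ pow R (- 1#) m * product f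
  product-neg m f = begin
    product (λ b → - f b)                 ≈⟨ product-cong {m} (λ b → sym (-1*x≈-x (f b))) ⟩
    product (λ b → - 1# * f b)            ≈⟨ product-distrib-* (λ _ → - 1#) f ⟩
    product {m} (λ _ → - 1#) * product f  ≈⟨ *-congʳ (product-const m (- 1#)) ⟩
    pow R (- 1#) m * product f            ∎

  foldr-*-map-upTo : ∀ n (f : ℕ → Carrier) → foldr _*_ 1# (map f (upTo n)) ≡ product {n} (λ j → f (toℕ j))
  foldr-*-map-upTo n f = go n (λ i → i)
    where
    go : ∀ n h → foldr _*_ 1# (map f (applyUpTo h n)) ≡ product {n} (λ j → f (h (toℕ j)))
    go zero h = ≡.refl
    go (suc n) h = ≡.cong (f (h 0) *_) (go n (h ∘ suc))

  minor : ∀ {n} → (Fin (suc n) → Fin (suc n) → Carrier) → Fin (suc n) → Fin n → Fin n → Carrier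
  minor M i a b = M (punchIn i a) (F.suc b)

  -- The same Laplace expansion as det, so that topCoeff-det follows it clause by clause.
  scalarDet : (n : ℕ) → (Fin n → Fin n → Carrier) → Carrier
  scalarDet zero M = 1#
  scalarDet (suc n) M = ∑[ i < suc n ] signed (toℕ i) (M i F.zero * scalarDet n (minor M i))

  laplaceTerm : ∀ n → (Fin (suc n) → Fin (suc n) → Carrier) → Fin (suc n) → Carrier
  laplaceTerm n M i = signed (toℕ i) (M i F.zero * scalarDet n (minor M i))

  scalarDet-cong : ∀ n {M M′ : Fin n → Fin n → Carrier} →
                   (∀ i j → M i j ≈ M′ i j) → scalarDet n M ≈ scalarDet n M′
  scalarDet-cong zero e = refl
  scalarDet-cong (suc n) e = sum-cong-≋ {suc n} λ i →
    signed-cong (toℕ i) (*-cong (e i F.zero) (scalarDet-cong n (λ a b → e (punchIn i a) (F.suc b))))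

  scalarDet-scale-columns : ∀ n (b : Fin n → Carrier) (M : Fin n → Fin n → Carrier) →
    scalarDet n (λ i j → b j * M i j) ≈ product b * scalarDet n M
  scalarDet-scale-columns zero b M = sym (*-identityʳ 1#)
  scalarDet-scale-columns (suc n) b M = begin
    scalarDet (suc n) (λ i j → b j * M i j)         ≈⟨ sum-cong-≋ {suc n} term ⟩
    ∑[ i < suc n ] (product b * laplaceTerm n M i)  ≈⟨ *-distribˡ-sum (product b) (laplaceTerm n M) ⟨
    product b * scalarDet (suc n) M                 ∎
    where
    term : ∀ i → laplaceTerm n (λ i j → b j * M i j) i ≈ product b * laplaceTerm n M i
    term i = begin
      signed (toℕ i) (b F.zero * M i F.zero * scalarDet n (λ a j → b (F.suc j) * minor M i a j))
        ≈⟨ signed-cong (toℕ i) (*-congˡ {b F.zero * M i F.zero}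
             (scalarDet-scale-columns n (b ∘ F.suc) (minor M i))) ⟩
      signed (toℕ i) (b F.zero * M i F.zero * (product (b ∘ F.suc) * scalarDet n (minor M i)))
        ≈⟨ signed-cong (toℕ i) (interchange (b F.zero) (M i F.zero) (product (b ∘ F.suc)) (scalarDet n (minor M i))) ⟩
      signed (toℕ i) (product b * (M i F.zero * scalarDet n (minor M i)))
        ≈⟨ signed-*ˡ (toℕ i) (product b) _ ⟩
      product b * laplaceTerm n M i ∎

  scalarDet-first-column : ∀ n (M : Fin (suc n) → Fin (suc n) → Carrier) →
    (∀ r → M (F.suc r) F.zero ≈ 0#) → scalarDet (suc n) M ≈ M F.zero F.zero * scalarDet n (minor M F.zero)
  scalarDet-first-column n M below = trans (+-congˡ rest) (+-identityʳ _)
    where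
    rest : ∑[ r < n ] laplaceTerm n M (F.suc r) ≈ 0#
    rest = trans (sum-cong-≋ {n} (λ r → signed-zero (suc (toℕ r)) (trans (*-congʳ (below r)) (zeroˡ _))))
                 (sum-replicate-zero n)

  scalarDet-linear-row : ∀ n (k : Fin n) (a : Carrier) {A B S : Fin n → Fin n → Carrier} →
    (∀ i → i ≢ k → ∀ j → S i j ≈ A i j) → (∀ i → i ≢ k → ∀ j → S i j ≈ B i j) →
    (∀ j → S k j ≈ A k j + a * B k j) →
    scalarDet n S ≈ scalarDet n A + a * scalarDet n B
  scalarDet-linear-row (suc n) k a {A} {B} {S} offA offB onK = begin
    scalarDet (suc n) S
      ≈⟨ sum-cong-≋ {suc n} term ⟩
    ∑[ i < suc n ] (laplaceTerm n A i + a * laplaceTerm n B i)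
      ≈⟨ ∑-distrib-+ (laplaceTerm n A) (λ i → a * laplaceTerm n B i) ⟩
    scalarDet (suc n) A + ∑[ i < suc n ] (a * laplaceTerm n B i)
      ≈⟨ +-congˡ (*-distribˡ-sum a (laplaceTerm n B)) ⟨
    scalarDet (suc n) A + a * scalarDet (suc n) B
      ∎
    where
    signed-linear : ∀ i x y → signed i (x + a * y) ≈ signed i x + a * signed i y
    signed-linear i x y = trans (signed-+ i x _) (+-congˡ (signed-*ˡ i a y))

    term : ∀ i → laplaceTerm n S i ≈ laplaceTerm n A i + a * laplaceTerm n B i
    term i with i FP.≟ k
    ... | yes ≡.refl = trans (signed-cong (toℕ i) (begin
            S i F.zero * scalarDet n (minor S i)
              ≈⟨ *-cong (onK F.zero) (scalarDet-cong n (λ a′ j → offA _ (FP.punchInᵢ≢i i a′) (F.suc j))) ⟩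
            (A i F.zero + a * B i F.zero) * scalarDet n (minor A i)
              ≈⟨ distribʳ _ (A i F.zero) (a * B i F.zero) ⟩
            A i F.zero * scalarDet n (minor A i) + a * B i F.zero * scalarDet n (minor A i)
              ≈⟨ +-congˡ (trans (*-assoc a _ _) (*-congˡ (*-congˡ (scalarDet-cong n minorsAB)))) ⟩
            A i F.zero * scalarDet n (minor A i) + a * (B i F.zero * scalarDet n (minor B i)) ∎))
          (signed-linear (toℕ i) _ _)
      where
      minorsAB : ∀ a′ j → minor A i a′ j ≈ minor B i a′ j
      minorsAB a′ j = trans (sym (offA _ (FP.punchInᵢ≢i i a′) (F.suc j))) (offB _ (FP.punchInᵢ≢i i a′) (F.suc j))
    ... | no i≢k = trans (signed-cong (toℕ i) (begin
            S i F.zero * scalarDet n (minor S i)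
              ≈⟨ *-congˡ (scalarDet-linear-row n k′ a offA′ offB′ onK′) ⟩
            S i F.zero * (scalarDet n (minor A i) + a * scalarDet n (minor B i))
              ≈⟨ distribˡ _ _ _ ⟩
            S i F.zero * scalarDet n (minor A i) + S i F.zero * (a * scalarDet n (minor B i))
              ≈⟨ +-cong (*-congʳ (offA i i≢k F.zero))
                        (trans (x∙yz≈y∙xz _ a _) (*-congˡ (*-congʳ (offB i i≢k F.zero)))) ⟩
            A i F.zero * scalarDet n (minor A i) + a * (B i F.zero * scalarDet n (minor B i)) ∎))
          (signed-linear (toℕ i) _ _)
      where
      k′ : Fin n
      k′ = punchOut i≢k

      avoids-k : ∀ a′ → a′ ≢ k′ → punchIn i a′ ≢ k
      avoids-k a′ a′≢k′ e = a′≢k′ (FP.punchIn-injective i a′ k′ (≡.trans e (≡.sym (FP.punchIn-punchOut i≢k))))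

      offA′ : ∀ a′ → a′ ≢ k′ → ∀ j → minor S i a′ j ≈ minor A i a′ j
      offA′ a′ ne j = offA _ (avoids-k a′ ne) (F.suc j)

      offB′ : ∀ a′ → a′ ≢ k′ → ∀ j → minor S i a′ j ≈ minor B i a′ j
      offB′ a′ ne j = offB _ (avoids-k a′ ne) (F.suc j)

      onK′ : ∀ j → minor S i k′ j ≈ minor A i k′ j + a * minor B i k′ j
      onK′ j = ≡.subst (λ r → S r (F.suc j) ≈ A r (F.suc j) + a * B r (F.suc j))
                       (≡.sym (FP.punchIn-punchOut i≢k)) (onK (F.suc j))

  sum-adjacent-cancel : ∀ {n} (f : Fin (suc (suc n)) → Carrier) (k : Fin (suc n)) →
    f (inject₁ k) + f (F.suc k) ≈ 0# → (∀ i → i ≢ inject₁ k → i ≢ F.suc k → f i ≈ 0#) →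
    sum f ≈ 0#
  sum-adjacent-cancel {n} f F.zero pair rest = begin
    f F.zero + (f (F.suc F.zero) + sum (f ∘ F.suc ∘ F.suc)) ≈⟨ +-assoc _ _ _ ⟨
    f F.zero + f (F.suc F.zero) + sum (f ∘ F.suc ∘ F.suc)   ≈⟨ +-cong pair rest-zero ⟩
    0# + 0#                                                 ≈⟨ +-identityˡ 0# ⟩
    0#                                                      ∎
    where
    rest-zero : sum (f ∘ F.suc ∘ F.suc) ≈ 0#
    rest-zero = trans (sum-cong-≋ {n} (λ i → rest _ (λ ()) (λ ()))) (sum-replicate-zero n)
  sum-adjacent-cancel {suc n} f (F.suc k) pair rest = begin
    f F.zero + sum (f ∘ F.suc)
      ≈⟨ +-cong (rest F.zero (λ ()) (λ ())) (sum-adjacent-cancel (f ∘ F.suc) k pair rest′) ⟩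
    0# + 0#
      ≈⟨ +-identityˡ 0# ⟩
    0#
      ∎
    where
    rest′ : ∀ i → i ≢ inject₁ k → i ≢ F.suc k → f (F.suc i) ≈ 0#
    rest′ i ne ne′ = rest (F.suc i) (ne ∘ FP.suc-injective) (ne′ ∘ FP.suc-injective)

  -- The two Laplace terms of the equal rows cancel; every other term has a minor
  -- which again has two equal adjacent rows.
  scalarDet-adjacent-equal-rows : ∀ {n} (M : Fin (suc n) → Fin (suc n) → Carrier) (k : Fin n) →
    (∀ j → M (inject₁ k) j ≈ M (F.suc k) j) → scalarDet (suc n) M ≈ 0#
  scalarDet-adjacent-equal-rows {suc n} M k equal = sum-adjacent-cancel (laplaceTerm (suc n) M) k pair others
    where
    D : Fin (suc (suc n)) → Carrier
    D i = M i F.zero * scalarDet (suc n) (minor M i)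

    minors-equal : ∀ a j → minor M (F.suc k) a j ≈ minor M (inject₁ k) a j
    minors-equal a j with a FP.≟ k
    ... | yes ≡.refl = ≡.subst₂ (λ u v → M u (F.suc j) ≈ M v (F.suc j))
                         (≡.sym (punchIn-suc-self a)) (≡.sym (punchIn-inject₁-self a)) (equal (F.suc j))
    ... | no a≢k = ≡.subst (λ u → M u (F.suc j) ≈ M (punchIn (inject₁ k) a) (F.suc j))
                     (≡.sym (punchIn-adjacent a≢k)) refl

    pair : laplaceTerm (suc n) M (inject₁ k) + laplaceTerm (suc n) M (F.suc k) ≈ 0#
    pair = begin
      signed (toℕ (inject₁ k)) (D (inject₁ k)) + - signed (toℕ k) (D (F.suc k))
        ≈⟨ +-congˡ (-‿cong (signed-cong (toℕ k)
             (*-cong (sym (equal F.zero)) (scalarDet-cong (suc n) minors-equal)))) ⟩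
      signed (toℕ (inject₁ k)) (D (inject₁ k)) + - signed (toℕ k) (D (inject₁ k))
        ≡⟨ ≡.cong (λ m → signed (toℕ (inject₁ k)) (D (inject₁ k)) + - signed m (D (inject₁ k)))
                  (FP.toℕ-inject₁ k) ⟨
      signed (toℕ (inject₁ k)) (D (inject₁ k)) + - signed (toℕ (inject₁ k)) (D (inject₁ k))
        ≈⟨ -‿inverseʳ _ ⟩
      0# ∎

    others : ∀ i → i ≢ inject₁ k → i ≢ F.suc k → laplaceTerm (suc n) M i ≈ 0#
    others i ne ne′ with punchIn-adjacent-preimage i k ne ne′
    ... | k₂ , e , e′ = signed-zero (toℕ i) (trans (*-congˡ (scalarDet-adjacent-equal-rows (minor M i) k₂ equal′))
                                                   (zeroʳ _))
      where
      equal′ : ∀ j → minor M i (inject₁ k₂) j ≈ minor M i (F.suc k₂) j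
      equal′ j = ≡.subst₂ (λ u v → M u (F.suc j) ≈ M v (F.suc j)) (≡.sym e) (≡.sym e′) (equal (F.suc j))

  scalarDet-add-previous-row : ∀ {n} (k : Fin n) (a : Carrier) {M S : Fin (suc n) → Fin (suc n) → Carrier} →
    (∀ i → i ≢ F.suc k → ∀ j → S i j ≈ M i j) →
    (∀ j → S (F.suc k) j ≈ M (F.suc k) j + a * M (inject₁ k) j) →
    scalarDet (suc n) S ≈ scalarDet (suc n) M
  scalarDet-add-previous-row {n} k a {M} {S} off on = begin
    scalarDet (suc n) S                            ≈⟨ scalarDet-linear-row (suc n) (F.suc k) a off offB onB ⟩
    scalarDet (suc n) M + a * scalarDet (suc n) B  ≈⟨ +-congˡ (*-congˡ (scalarDet-adjacent-equal-rows B k equal)) ⟩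
    scalarDet (suc n) M + a * 0#                   ≈⟨ +-congˡ (zeroʳ a) ⟩
    scalarDet (suc n) M + 0#                       ≈⟨ +-identityʳ _ ⟩
    scalarDet (suc n) M                            ∎
    where
    B : Fin (suc n) → Fin (suc n) → Carrier
    B = replaceRow M (F.suc k) (M (inject₁ k))

    offB : ∀ i → i ≢ F.suc k → ∀ j → S i j ≈ B i j
    offB i i≢k j rewrite replaceRow-≢ M (M (inject₁ k)) i≢k = off i i≢k j

    onB : ∀ j → S (F.suc k) j ≈ M (F.suc k) j + a * B (F.suc k) j
    onB j rewrite replaceRow-≡ M (F.suc k) (M (inject₁ k)) = on j

    equal : ∀ j → B (inject₁ k) j ≈ B (F.suc k) j
    equal j rewrite replaceRow-≢ M (M (inject₁ k)) (inject₁≢suc k) | replaceRow-≡ M (F.suc k) (M (inject₁ k))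
      = refl

  addPreviousRows : ∀ {n m} → (Fin n → Carrier) →
                    (Fin (suc n) → Fin m → Carrier) → Fin (suc n) → Fin m → Carrier
  addPreviousRows cs F F.zero j = F F.zero j
  addPreviousRows cs F (F.suc r) j = F (F.suc r) j + cs r * F (inject₁ r) j

  module _ {n} (cs : Fin n → Carrier) (F : Fin (suc n) → Fin (suc n) → Carrier) where

    -- Rows are changed from the bottom up, so that every step adds a multiple of a row
    -- that is still unchanged.
    private
      coeffsFrom : ℕ → Fin n → Carrier
      coeffsFrom t r with t ≤? toℕ r
      ... | yes _ = cs r
      ... | no _ = 0#

      coeffsFrom-≢ : ∀ t r → toℕ r ≢ t → coeffsFrom t r ≡ coeffsFrom (suc t) r
      coeffsFrom-≢ t r r≢t with t ≤? toℕ r | suc t ≤? toℕ r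
      ... | yes _ | yes _ = ≡.refl
      ... | no _ | no _ = ≡.refl
      ... | yes t≤r | no t≮r = ⊥-elim (r≢t (NP.≤-antisym (NP.≮⇒≥ t≮r) t≤r))
      ... | no t≰r | yes t<r = ⊥-elim (t≰r (NP.<⇒≤ t<r))

      coeffsFrom-self : ∀ r → coeffsFrom (toℕ r) r ≡ cs r
      coeffsFrom-self r with toℕ r ≤? toℕ r
      ... | yes _ = ≡.refl
      ... | no r≰r = ⊥-elim (r≰r NP.≤-refl)

      partial : ℕ → Fin (suc n) → Fin (suc n) → Carrier
      partial t = addPreviousRows (coeffsFrom t) F

      partial-unchanged : ∀ t i j → toℕ i ≤ t → partial t i j ≈ F i j
      partial-unchanged t F.zero j _ = refl
      partial-unchanged t (F.suc r) j r<t with t ≤? toℕ r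
      ... | yes t≤r = ⊥-elim (NP.<⇒≱ r<t t≤r)
      ... | no _ = trans (+-congˡ (zeroˡ _)) (+-identityʳ _)

      partial-step : ∀ r → scalarDet (suc n) (partial (toℕ r)) ≈ scalarDet (suc n) (partial (suc (toℕ r)))
      partial-step r = scalarDet-add-previous-row r (cs r) off on
        where
        off : ∀ i → i ≢ F.suc r → ∀ j → partial (toℕ r) i j ≈ partial (suc (toℕ r)) i j
        off F.zero _ j = refl
        off (F.suc i) i≢r j rewrite coeffsFrom-≢ (toℕ r) i (i≢r ∘ ≡.cong F.suc ∘ FP.toℕ-injective) = refl

        on : ∀ j → partial (toℕ r) (F.suc r) j ≈
                   partial (suc (toℕ r)) (F.suc r) j + cs r * partial (suc (toℕ r)) (inject₁ r) j
        on j rewrite coeffsFrom-self r = +-cong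
          (sym (partial-unchanged (suc (toℕ r)) (F.suc r) j NP.≤-refl))
          (*-congˡ (sym (partial-unchanged (suc (toℕ r)) (inject₁ r) j
             (NP.≤-trans (NP.≤-reflexive (FP.toℕ-inject₁ r)) (NP.n≤1+n _)))))

      partial-from : ∀ u t → t N.+ u ≡ n → scalarDet (suc n) (partial t) ≈ scalarDet (suc n) F
      partial-from zero t t+0≡n = scalarDet-cong (suc n) λ i j → partial-unchanged t i j
        (≡.subst (toℕ i ≤_) (≡.trans (≡.sym t+0≡n) (NP.+-identityʳ t)) (NP.≤-pred (FP.toℕ<n i)))
      partial-from (suc u) t t+1+u≡n = trans
        (≡.subst (λ s → scalarDet (suc n) (partial s) ≈ scalarDet (suc n) (partial (suc s)))
                 (FP.toℕ-fromℕ< t<n) (partial-step (F.fromℕ< t<n)))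
        (partial-from u (suc t) (≡.trans (≡.sym (NP.+-suc t u)) t+1+u≡n))
        where
        t<n : t < n
        t<n = ≡.subst (t <_) t+1+u≡n (NP.m<m+n t (s≤s z≤n))

    scalarDet-add-previous-rows : scalarDet (suc n) (addPreviousRows cs F) ≈ scalarDet (suc n) F
    scalarDet-add-previous-rows = trans (scalarDet-cong (suc n) from-zero) (partial-from n 0 ≡.refl)
      where
      from-zero : ∀ i j → addPreviousRows cs F i j ≈ partial 0 i j
      from-zero F.zero j = refl
      from-zero (F.suc r) j = refl

  TopCoeff : ℕ → Carrier → Poly R → Set ℓ
  TopCoeff d v p = (∀ m → d < m → coeff R p m ≈ 0#) × coeff R p d ≈ v

  topCoeff-cong : ∀ {d u v p} → u ≈ v → TopCoeff d u p → TopCoeff d v p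
  topCoeff-cong u≈v (above , top) = above , trans top u≈v

  coeff-padd : ∀ p r m → coeff R (padd R p r) m ≈ coeff R p m + coeff R r m
  coeff-padd [] r m = sym (+-identityˡ _)
  coeff-padd (a ∷ p) [] m = sym (+-identityʳ _)
  coeff-padd (a ∷ p) (b ∷ r) zero = refl
  coeff-padd (a ∷ p) (b ∷ r) (suc m) = coeff-padd p r m

  coeff-scale : ∀ a p m → coeff R (map (a *_) p) m ≈ a * coeff R p m
  coeff-scale a [] m = sym (zeroʳ a)
  coeff-scale a (b ∷ p) zero = refl
  coeff-scale a (b ∷ p) (suc m) = coeff-scale a p m

  coeff-pneg : ∀ p m → coeff R (pneg R p) m ≈ - coeff R p m
  coeff-pneg [] m = sym -0#≈0#
  coeff-pneg (b ∷ p) zero = refl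
  coeff-pneg (b ∷ p) (suc m) = coeff-pneg p m

  coeff-pmul-∷ : ∀ a p r m → coeff R (pmul R (a ∷ p) r) m ≈ a * coeff R r m + coeff R (0# ∷ pmul R p r) m
  coeff-pmul-∷ a p r m = trans (coeff-padd (map (a *_) r) _ m) (+-congʳ (coeff-scale a r m))

  coeff-pmul-zero : ∀ p r → (∀ m → coeff R p m ≈ 0#) → ∀ m → coeff R (pmul R p r) m ≈ 0#
  coeff-pmul-zero [] r p≈0 m = refl
  coeff-pmul-zero (a ∷ p) r p≈0 m = begin
    coeff R (pmul R (a ∷ p) r) m                   ≈⟨ coeff-pmul-∷ a p r m ⟩
    a * coeff R r m + coeff R (0# ∷ pmul R p r) m  ≈⟨ +-cong (trans (*-congʳ (p≈0 zero)) (zeroˡ _)) (shifted m) ⟩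
    0# + 0#                                        ≈⟨ +-identityˡ 0# ⟩
    0#                                             ∎
    where
    shifted : ∀ m → coeff R (0# ∷ pmul R p r) m ≈ 0#
    shifted zero = refl
    shifted (suc m) = coeff-pmul-zero p r (p≈0 ∘ suc) m

  topCoeff-padd : ∀ {d u v} p r → TopCoeff d u p → TopCoeff d v r → TopCoeff d (u + v) (padd R p r)
  topCoeff-padd p r (aboveP , topP) (aboveR , topR) =
    (λ m d<m → trans (coeff-padd p r m) (trans (+-cong (aboveP m d<m) (aboveR m d<m)) (+-identityʳ 0#))) ,
    trans (coeff-padd p r _) (+-cong topP topR)

  topCoeff-psign : ∀ {d v} k p → TopCoeff d v p → TopCoeff d (signed k v) (psign R k p)
  topCoeff-psign zero p t = t
  topCoeff-psign (suc k) p t with topCoeff-psign k p t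
  ... | above , top =
    (λ m d<m → trans (coeff-pneg (psign R k p) m) (trans (-‿cong (above m d<m)) -0#≈0#)) ,
    trans (coeff-pneg (psign R k p) _) (-‿cong top)

  topCoeff-pmul : ∀ {u v} p r d e → TopCoeff d u p → TopCoeff e v r → TopCoeff (d N.+ e) (u * v) (pmul R p r)
  topCoeff-pmul [] r d e (_ , top) _ = (λ _ _ → refl) , trans (sym (zeroˡ _)) (*-congʳ top)
  topCoeff-pmul (a ∷ p) r zero e (aboveP , topP) (aboveR , topR) =
    (λ m e<m → trans (coeff-pmul-∷ a p r m)
                 (trans (+-cong (trans (*-congˡ (aboveR m e<m)) (zeroʳ a)) (tail-zero m)) (+-identityʳ 0#))) ,
    trans (coeff-pmul-∷ a p r e) (trans (+-cong (*-cong topP topR) (tail-zero e)) (+-identityʳ _))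
    where
    tail-zero : ∀ m → coeff R (0# ∷ pmul R p r) m ≈ 0#
    tail-zero zero = refl
    tail-zero (suc m) = coeff-pmul-zero p r (λ m → aboveP (suc m) (s≤s z≤n)) m
  topCoeff-pmul (a ∷ p) r (suc d) e (aboveP , topP) tR@(aboveR , _) =
    (λ { (suc m) (s≤s d+e<m) → trans (coeff-pmul-∷ a p r (suc m))
           (trans (+-cong (head-zero (suc m) (s≤s (NP.≤-trans (NP.m≤n+m e d) (NP.<⇒≤ d+e<m))))
                          (proj₁ tail m d+e<m))
                  (+-identityʳ 0#)) }) ,
    trans (coeff-pmul-∷ a p r (suc (d N.+ e)))
          (trans (+-cong (head-zero _ (s≤s (NP.m≤n+m e d))) (proj₂ tail)) (+-identityˡ _))
    where
    tail : TopCoeff (d N.+ e) _ (pmul R p r)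
    tail = topCoeff-pmul p r d e ((λ m d<m → aboveP (suc m) (s≤s d<m)) , topP) tR

    head-zero : ∀ m → e < m → a * coeff R r m ≈ 0#
    head-zero m e<m = trans (*-congˡ (aboveR m e<m)) (zeroʳ a)

  topCoeff-psum : ∀ {m} d (f : Fin m → Poly R) (v : Fin m → Carrier) →
    (∀ i → TopCoeff d (v i) (f i)) → TopCoeff d (sum v) (psum R (tabulate f))
  topCoeff-psum {zero} d f v t = (λ _ _ → refl) , refl
  topCoeff-psum {suc m} d f v t =
    topCoeff-padd (f F.zero) _ (t F.zero) (topCoeff-psum d (f ∘ F.suc) (v ∘ F.suc) (t ∘ F.suc))

  topCoeff-det : ∀ n (M : Fin n → Fin n → Poly R) (r s : Fin n → ℕ) (T : Fin n → Fin n → Carrier) →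
    (∀ i j → TopCoeff (r i N.+ s j) (T i j) (M i j)) →
    TopCoeff (ℕ-Sum.sum r N.+ ℕ-Sum.sum s) (scalarDet n T) (det R n M)
  topCoeff-det zero M r s T t = (λ { (suc m) _ → refl }) , refl
  topCoeff-det (suc n) M r s T t =
    ≡.subst (λ P → TopCoeff (ℕ-Sum.sum r N.+ ℕ-Sum.sum s) (scalarDet (suc n) T) (psum R P))
            (≡.sym (LP.map-tabulate (λ i → i) term))
            (topCoeff-psum _ term _ topCoeff-term)
    where
    minorDet : Fin (suc n) → Poly R
    minorDet i = det R n (λ a b → M (punchIn i a) (F.suc b))

    term : Fin (suc n) → Poly R
    term i = psign R (toℕ i) (pmul R (M i F.zero) (minorDet i))

    degree : ∀ i → (r i N.+ s F.zero) N.+ (ℕ-Sum.sum (r ∘ punchIn i) N.+ ℕ-Sum.sum (s ∘ F.suc))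
                   ≡ ℕ-Sum.sum r N.+ ℕ-Sum.sum s
    degree i = ≡.trans (ℕ-Semigroup.interchange (r i) (s F.zero) _ _)
                       (≡.cong (N._+ ℕ-Sum.sum s) (≡.sym (ℕ-Sum.sum-remove {i = i} r)))

    topCoeff-term : ∀ i → TopCoeff (ℕ-Sum.sum r N.+ ℕ-Sum.sum s) (laplaceTerm n T i) (term i)
    topCoeff-term i = topCoeff-psign (toℕ i) _
      (≡.subst (λ d → TopCoeff d (T i F.zero * scalarDet n (minor T i)) (pmul R (M i F.zero) (minorDet i)))
        (degree i)
        (topCoeff-pmul (M i F.zero) (minorDet i) (r i N.+ s F.zero) _ (t i F.zero)
          (topCoeff-det n (λ a b → M (punchIn i a) (F.suc b)) (r ∘ punchIn i) (s ∘ F.suc) (minor T i)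
                        (λ a b → t (punchIn i a) (F.suc b)))))

  module _ (q : Carrier) where

    qMatrix : ℕ → ∀ {m} → Fin m → Fin m → Carrier
    qMatrix s i j = pow R q (qExponent s (toℕ i) (toℕ j))

    qStep : ℕ → ∀ {n} → Fin n → Carrier
    qStep s r = - pow R q (s N.+ toℕ r)

    columnFactor : ℕ → ∀ {n} → Fin n → Carrier
    columnFactor s b = pow R q (s N.+ toℕ b) * (pow R q (suc (toℕ b)) + - 1#)

    qReduced-row : ∀ s {n} (a : Fin n) (j : Fin (suc n)) →
      addPreviousRows (qStep s) (qMatrix s) (F.suc a) j ≈
      pow R q (s N.+ toℕ a) * (pow R q (toℕ j) + - 1#) * pow R q (qExponent s (toℕ a) (toℕ j))
    qReduced-row s a j = begin
      pow R q (qExponent s (suc (toℕ a)) (toℕ j)) + - y * pow R q (qExponent s (toℕ (inject₁ a)) (toℕ j))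
        ≈⟨ +-cong (pow-cong q (qExponent-next-row s (toℕ a) (toℕ j)))
                  (*-congˡ (pow-cong q (≡.cong (λ i → qExponent s i (toℕ j)) (FP.toℕ-inject₁ a)))) ⟩
      pow R q ((s N.+ toℕ a) N.+ toℕ j N.+ e) + - y * x
        ≈⟨ +-cong (trans (pow-+ q ((s N.+ toℕ a) N.+ toℕ j) e) (*-congʳ (pow-+ q (s N.+ toℕ a) (toℕ j))))
                  (sym (-‿distribˡ-* y x)) ⟩
      y * z * x + - (y * x)
        ≈⟨ +-congˡ (-‿cong (*-congʳ (*-identityʳ y))) ⟨
      y * z * x + - (y * 1# * x)
        ≈⟨ +-congˡ (-‿distribˡ-* (y * 1#) x) ⟩
      y * z * x + - (y * 1#) * x
        ≈⟨ distribʳ x (y * z) _ ⟨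
      (y * z + - (y * 1#)) * x
        ≈⟨ *-congʳ (+-congˡ (-‿distribʳ-* y 1#)) ⟩
      (y * z + y * - 1#) * x
        ≈⟨ *-congʳ (distribˡ y z (- 1#)) ⟨
      y * (z + - 1#) * x
        ∎
      where
      e = qExponent s (toℕ a) (toℕ j)
      x = pow R q e
      y = pow R q (s N.+ toℕ a)
      z = pow R q (toℕ j)

    qReduced-first-column : ∀ s {n} (a : Fin n) → addPreviousRows (qStep s) (qMatrix s) (F.suc a) F.zero ≈ 0#
    qReduced-first-column s a =
      trans (qReduced-row s a F.zero) (trans (*-congʳ (trans (*-congˡ (-‿inverseʳ 1#)) (zeroʳ _))) (zeroˡ _))

    qReduced-minor : ∀ s {n} (a b : Fin n) →
      addPreviousRows (qStep s) (qMatrix s) (F.suc a) (F.suc b) ≈ columnFactor s b * qMatrix (s N.+ 2) a b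
    qReduced-minor s a b = begin
      addPreviousRows (qStep s) (qMatrix s) (F.suc a) (F.suc b)  ≈⟨ qReduced-row s a (F.suc b) ⟩
      y * w * x                                                  ≈⟨ xy∙z≈y∙xz y w x ⟩
      w * (y * x)                                                ≈⟨ *-congˡ shift ⟩
      w * (y′ * x′)                                              ≈⟨ xy∙z≈y∙xz y′ w x′ ⟨
      y′ * w * x′                                                ∎
      where
      y = pow R q (s N.+ toℕ a)
      y′ = pow R q (s N.+ toℕ b)
      w = pow R q (suc (toℕ b)) + - 1#
      x = pow R q (qExponent s (toℕ a) (suc (toℕ b)))
      x′ = pow R q (qExponent (s N.+ 2) (toℕ a) (toℕ b))

      shift : y * x ≈ y′ * x′
      shift = trans (sym (pow-+ q (s N.+ toℕ a) _))
                    (trans (pow-cong q (qExponent-shift s (toℕ a) (toℕ b))) (pow-+ q (s N.+ toℕ b) _))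

    scalarDet-qMatrix-step : ∀ s n →
      scalarDet (suc (suc n)) (qMatrix s) ≈ product (columnFactor s {suc n}) * scalarDet (suc n) (qMatrix (s N.+ 2))
    scalarDet-qMatrix-step s n = begin
      scalarDet (suc (suc n)) (qMatrix s)
        ≈⟨ scalarDet-add-previous-rows (qStep s {suc n}) (qMatrix s) ⟨
      scalarDet (suc (suc n)) reduced
        ≈⟨ scalarDet-first-column (suc n) reduced (qReduced-first-column s) ⟩
      qMatrix s {suc (suc n)} F.zero F.zero * scalarDet (suc n) (minor reduced F.zero)
        ≈⟨ *-cong (pow-cong q (≡.cong (N._+ 0) (NP.*-zeroʳ s))) (scalarDet-cong (suc n) (qReduced-minor s)) ⟩
      1# * scalarDet (suc n) (λ a b → columnFactor s b * qMatrix (s N.+ 2) a b)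
        ≈⟨ *-identityˡ _ ⟩
      scalarDet (suc n) (λ a b → columnFactor s b * qMatrix (s N.+ 2) a b)
        ≈⟨ scalarDet-scale-columns (suc n) (columnFactor s) (qMatrix (s N.+ 2)) ⟩
      product (columnFactor s {suc n}) * scalarDet (suc n) (qMatrix (s N.+ 2))
        ∎
      where
      reduced : Fin (suc (suc n)) → Fin (suc (suc n)) → Carrier
      reduced = addPreviousRows (qStep s {suc n}) (qMatrix s)

    qFactor : ℕ → Carrier
    qFactor i = 1# - pow R q (suc i)

    qPochhammer : ℕ → Carrier
    qPochhammer m = product {m} (λ j → qFactor (toℕ j))

    qSuperfactorial : ℕ → Carrier
    qSuperfactorial n = product {n} (λ j → pow R (qFactor (toℕ j)) (n ∸ toℕ j))

    qSuperfactorial-suc : ∀ n → qSuperfactorial (suc n) ≈ qPochhammer (suc n) * qSuperfactorial n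
    qSuperfactorial-suc n = begin
      product {suc n} (λ j → pow R (x j) (suc n ∸ toℕ j))
        ≈⟨ product-cong {suc n} (λ j → pow-cong (x j) (NP.+-∸-assoc 1 (NP.≤-pred (FP.toℕ<n j)))) ⟩
      product {suc n} (λ j → x j * g j)
        ≈⟨ product-distrib-* x g ⟩
      qPochhammer (suc n) * product g
        ≈⟨ *-congˡ (product-init-last g) ⟩
      qPochhammer (suc n) * (product (g ∘ inject₁) * g (F.fromℕ n))
        ≈⟨ *-congˡ (*-cong (product-cong {n} (λ j → pow-cong′ (FP.toℕ-inject₁ j)))
                           (pow-cong (x (F.fromℕ n))
                                     (≡.trans (≡.cong (n ∸_) (FP.toℕ-fromℕ n)) (NP.n∸n≡0 n)))) ⟩
      qPochhammer (suc n) * (qSuperfactorial n * 1#)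
        ≈⟨ *-congˡ (*-identityʳ _) ⟩
      qPochhammer (suc n) * qSuperfactorial n
        ∎
      where
      x : Fin (suc n) → Carrier
      x j = qFactor (toℕ j)

      g : Fin (suc n) → Carrier
      g j = pow R (x j) (n ∸ toℕ j)

      pow-cong′ : ∀ {i k} → i ≡ k → pow R (qFactor i) (n ∸ i) ≈ pow R (qFactor k) (n ∸ k)
      pow-cong′ ≡.refl = refl

    product-columnFactor : ∀ s m → product (columnFactor s {m}) ≈
      pow R q (ℕ-Sum.sum {m} (λ b → s N.+ toℕ b)) * (pow R (- 1#) m * qPochhammer m)
    product-columnFactor s m = begin
      product (columnFactor s {m})
        ≈⟨ product-distrib-* {m} (λ b → pow R q (s N.+ toℕ b)) (λ b → pow R q (suc (toℕ b)) + - 1#) ⟩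
      product {m} (λ b → pow R q (s N.+ toℕ b)) * product {m} (λ b → pow R q (suc (toℕ b)) + - 1#)
        ≈⟨ *-cong (product-pow m q (λ b → s N.+ toℕ b))
                  (trans (product-cong {m} (λ b → flip (toℕ b))) (product-neg m _)) ⟩
      pow R q (ℕ-Sum.sum {m} (λ b → s N.+ toℕ b)) * (pow R (- 1#) m * qPochhammer m)
        ∎
      where
      flip : ∀ i → pow R q (suc i) + - 1# ≈ - qFactor i
      flip i = begin
        pow R q (suc i) + - 1#      ≈⟨ +-congʳ (-‿involutive _) ⟨
        - - pow R q (suc i) + - 1#  ≈⟨ +-comm _ _ ⟩
        - 1# + - - pow R q (suc i)  ≈⟨ -‿+-comm 1# _ ⟩
        - (1# + - pow R q (suc i))  ∎

    qMatrixDet : ℕ → ℕ → Carrier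
    qMatrixDet s n =
      pow R (- 1#) (suc n C 2) * (pow R q (s N.* (suc n C 2) N.+ 3 N.* (suc n C 3)) * qSuperfactorial n)

    scalarDet-qMatrix : ∀ n s → scalarDet (suc n) (qMatrix s) ≈ qMatrixDet s n
    scalarDet-qMatrix zero s = trans (+-identityʳ _) (sym (*-identityˡ _))
    scalarDet-qMatrix (suc n) s = begin
      scalarDet (suc (suc n)) (qMatrix s)
        ≈⟨ scalarDet-qMatrix-step s n ⟩
      product (columnFactor s {suc n}) * scalarDet (suc n) (qMatrix (s N.+ 2))
        ≈⟨ *-cong (product-columnFactor s (suc n)) (scalarDet-qMatrix n (s N.+ 2)) ⟩
      (pow R q e₁ * (pow R (- 1#) (suc n) * qPochhammer (suc n))) *
      (pow R (- 1#) (suc n C 2) * (pow R q e₂ * qSuperfactorial n))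
        ≈⟨ rearrange _ _ _ _ _ _ ⟩
      (pow R (- 1#) (suc n) * pow R (- 1#) (suc n C 2)) *
      ((pow R q e₁ * pow R q e₂) * (qPochhammer (suc n) * qSuperfactorial n))
        ≈⟨ *-cong (pow-+ (- 1#) (suc n) _) (*-cong (pow-+ q e₁ e₂) (qSuperfactorial-suc n)) ⟨
      pow R (- 1#) (suc n N.+ suc n C 2) * (pow R q (e₁ N.+ e₂) * qSuperfactorial (suc n))
        ≈⟨ *-cong (pow-cong (- 1#) (≡.trans (NP.+-comm (suc n) _) (≡.sym (C2-suc (suc n)))))
                  (*-congʳ (pow-cong q (qDetExponent-step s n))) ⟩
      qMatrixDet s (suc n)
        ∎
      where
      e₁ = ℕ-Sum.sum {suc n} (λ b → s N.+ toℕ b)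
      e₂ = (s N.+ 2) N.* (suc n C 2) N.+ 3 N.* (suc n C 3)

      rearrange : ∀ a b c d e f → (a * (b * c)) * (d * (e * f)) ≈ (b * d) * ((a * e) * (c * f))
      rearrange = CM.solve 6 (λ a b c d e f → ((a CM.⊕ (b CM.⊕ c)) CM.⊕ (d CM.⊕ (e CM.⊕ f)))
                                       CM.⊜ ((b CM.⊕ d) CM.⊕ ((a CM.⊕ e) CM.⊕ (c CM.⊕ f)))) refl

    qbinom-above : ∀ n k → n < k → qbinom R q n k ≈ 0#
    qbinom-above zero (suc k) _ = refl
    qbinom-above (suc n) (suc k) (s≤s n<k) = trans
      (+-cong (qbinom-above n k n<k) (trans (*-congˡ (qbinom-above n (suc k) (NP.m<n⇒m<1+n n<k))) (zeroʳ _)))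
      (+-identityʳ 0#)

    qbinom-diagonal : ∀ k → qbinom R q k k ≈ 1#
    qbinom-diagonal zero = refl
    qbinom-diagonal (suc k) = trans
      (+-cong (qbinom-diagonal k) (trans (*-congˡ (qbinom-above k (suc k) NP.≤-refl)) (zeroʳ _)))
      (+-identityʳ 1#)

    topCoeff-alphaPoly : ∀ α k → TopCoeff k (α 0 * pow R q (k C 2)) (alphaPoly R q α k)
    topCoeff-alphaPoly α k =
      (λ m k<m → reflexive (coeff-beyond {λ i → i} (suc k) m k<m)) ,
      trans (reflexive (coeff-within {λ i → i} (suc k) k NP.≤-refl)) top
      where
      f : ℕ → Carrier
      f l = pow R q (l C 2) * (qbinom R q k l * α (k ∸ l))

      coeff-within : ∀ {h} m j → j < m → coeff R (map f (applyUpTo h m)) j ≡ f (h j)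
      coeff-within (suc m) zero _ = ≡.refl
      coeff-within (suc m) (suc j) (s≤s j<m) = coeff-within m j j<m

      coeff-beyond : ∀ {h} m j → m ≤ j → coeff R (map f (applyUpTo h m)) j ≡ 0#
      coeff-beyond zero j _ = ≡.refl
      coeff-beyond (suc m) (suc j) (s≤s m≤j) = coeff-beyond m j m≤j

      top : f k ≈ α 0 * pow R q (k C 2)
      top = begin
        pow R q (k C 2) * (qbinom R q k k * α (k ∸ k))
          ≈⟨ *-congˡ (*-cong (qbinom-diagonal k) (reflexive (≡.cong α (NP.n∸n≡0 k)))) ⟩
        pow R q (k C 2) * (1# * α 0)  ≈⟨ *-congˡ (*-identityˡ _) ⟩
        pow R q (k C 2) * α 0         ≈⟨ *-comm _ _ ⟩
        α 0 * pow R q (k C 2)         ∎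

    topCoeff-hankel : ∀ α n → TopCoeff (n N.* suc n) (leadCoeff R q α n) (hankel R (alphaPoly R q α) n)
    topCoeff-hankel α n = ≡.subst (λ d → TopCoeff d (leadCoeff R q α n) H) degree
      (topCoeff-cong {p = H} value
        (topCoeff-det (suc n) (λ i j → alphaPoly R q α (toℕ i N.+ toℕ j)) toℕ toℕ (λ i j → α 0 * qMatrix 0 i j)
                      (λ i j → topCoeff-alphaPoly α (toℕ i N.+ toℕ j))))
      where
      H = hankel R (alphaPoly R q α) n

      degree : ℕ-Sum.sum {suc n} toℕ N.+ ℕ-Sum.sum {suc n} toℕ ≡ n N.* suc n
      degree = ≡.trans (≡.cong₂ N._+_ (sum-toℕ (suc n)) (sum-toℕ (suc n))) (C2-double n)

      value : scalarDet (suc n) (λ i j → α 0 * qMatrix 0 i j) ≈ leadCoeff R q α n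
      value = begin
        scalarDet (suc n) (λ i j → α 0 * qMatrix 0 i j)
          ≈⟨ scalarDet-scale-columns (suc n) (λ _ → α 0) (qMatrix 0) ⟩
        product {suc n} (λ _ → α 0) * scalarDet (suc n) (qMatrix 0)
          ≈⟨ *-cong (product-const (suc n) (α 0)) (scalarDet-qMatrix n 0) ⟩
        pow R (α 0) (suc n) * qMatrixDet 0 n
          ≡⟨ ≡.cong (λ p → pow R (α 0) (suc n) * (pow R (- 1#) (suc n C 2) * (pow R q (3 N.* (suc n C 3)) * p)))
                    (foldr-*-map-upTo n (λ j → pow R (qFactor j) (n ∸ j))) ⟨
        leadCoeff R q α n
          ∎

theorem1p4 : ∀ {c ℓ : Level} (R : CommutativeRing c ℓ) →
    let open CommutativeRing R in
    (q : Carrier) (α : ℕ → Carrier) (n : ℕ) →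
      (coeff R (hankel R (alphaPoly R q α) n) (n N.* suc n) ≈ leadCoeff R q α n)
      × (∀ m → n N.* suc n N.< m → coeff R (hankel R (alphaPoly R q α) n) m ≈ 0#)
theorem1p4 R q α n = proj₂ top , proj₁ top
  where
  top = topCoeff-hankel R q α n
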